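{- Let $n\ge 2$, $0\le p\le n$, and $\mathbf{J}=\operatorname{Diag}(\mathbf{I}_p,-\mathbf{I}_{n-p})\in\mathbb{R}^{n\times n}$. Let $\mathcal{B}=(\mathcal{B}_1,\mathcal{B}_2)$ be a pair of distinct indices in $[n]$, and let $\mathbf{U}_{\mathcal{B}}\in\mathbb{R}^{n\times 2}$ be given by $(\mathbf{U}_{\mathcal{B}})_{ji}=1$ if $\mathcal{B}_i=j$ and $0$ otherwise. Let $\mathbf{J}_{\mathcal{B}\mathcal{B}}\in\mathbb{R}^{2\times 2}$ be the principal submatrix of $\mathbf{J}$ indexed by $\mathcal{B}$ and $\mathcal{J}_{\mathcal{B}}=\{\mathbf{V}\in\mathbb{R}^{2\times 2}:\mathbf{V}^{\top}\mathbf{J}_{\mathcal{B}\mathcal{B}}\mathbf{V}=\mathbf{J}_{\mathcal{B}\mathcal{B}}\}$, and let $\mathcal{J}=\{\mathbf{X}\in\mathbb{R}^{n\times n}:\mathbf{X}^{\top}\mathbf{J}\mathbf{X}=\mathbf{J}\}$. For $\mathbf{X}\in\mathbb{R}^{n\times n}$ and $\mathbf{V}\in\mathbb{R}^{2\times 2}$ define $\mathbf{X}^{+}=\mathbf{X}+\mathbf{U}_{\mathcal{B}}(\mathbf{V}-\mathbf{I}_2)\mathbf{U}_{\mathcal{B}}^{\top}\mathbf{X}$. Let $\mathbf{H}\in\mathbb{R}^{n^2\times n^2}$ be symmetric positive semidefinite. Then: (a) if $\mathbf{V}\in\mathcal{J}_{\mathcal{B}}$ and $\mathbf{X}\in\mathcal{J}$,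 then $\mathbf{X}^{+}\in\mathcal{J}$; (b) $\|\mathbf{X}^{+}-\mathbf{X}\|_F^2\le\|\mathbf{X}\|_F^2\,\|\mathbf{V}-\mathbf{I}_2\|_F^2$; (c) $\|\mathbf{X}^{+}-\mathbf{X}\|_{\mathbf{H}}^2\le\|\mathbf{V}-\mathbf{I}_2\|_{\mathbf{Q}}^2$ for every symmetric $\mathbf{Q}\in\mathbb{R}^{4\times 4}$ with $\mathbf{Q}\succcurlyeq\underline{\mathbf{Q}}\triangleq(\mathbf{Z}^{\top}\otimes\mathbf{U}_{\mathcal{B}})^{\top}\mathbf{H}(\mathbf{Z}^{\top}\otimes\mathbf{U}_{\mathcal{B}})$, where $\mathbf{Z}\triangleq\mathbf{U}_{\mathcal{B}}^{\top}\mathbf{X}\in\mathbb{R}^{2\times n}$.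
   Context: For a matrix $\mathbf{Y}$ and a symmetric matrix $\mathbf{M}$ of matching size, $\|\mathbf{Y}\|_{\mathbf{M}}^2\triangleq\operatorname{vec}(\mathbf{Y})^{\top}\mathbf{M}\operatorname{vec}(\mathbf{Y})$, where $\operatorname{vec}$ stacks columns. $\otimes$ is the Kronecker product. -}

module Defs where

open import Level using (0ℓ)
open import Data.Nat as ℕ using (ℕ; suc; zero)
open import Data.Fin as Fin using (Fin; toℕ; combine; remQuot)
open import Data.Product using (Σ; ∃; _×_; _,_)
open import Data.Bool using (if_then_else_)
open import Relation.Nullary using (¬_)
open import Relation.Nullary.Decidable using (⌊_⌋)
open import Relation.Binary.PropositionalEquality using (_≡_; _≢_)
open import Relation.Binary.Structures using (IsTotalOrder)
open import Algebra.Structures using (IsCommutativeRing)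

-- Any model of this record
-- is isomorphic to ℝ; the theorem is stated for every such model.

record Reals : Set₁ where
  infixl 6 _+_
  infixl 7 _*_
  infix  4 _≤_
  field
    ℝ    : Set
    0r   : ℝ
    1r   : ℝ
    _+_  : ℝ → ℝ → ℝ
    _*_  : ℝ → ℝ → ℝ
    -_   : ℝ → ℝ
    _≤_  : ℝ → ℝ → Set
    isCommutativeRing : IsCommutativeRing _≡_ _+_ _*_ -_ 0r 1r
    0≢1      : 0r ≢ 1r
    inverse  : ∀ x → x ≢ 0r → Σ ℝ (λ y → x * y ≡ 1r)
    isTotalOrder : IsTotalOrder _≡_ _≤_
    +-monoˡ-≤ : ∀ {x y} z → x ≤ y → x + z ≤ y + z
    *-nonneg  : ∀ {x y} → 0r ≤ x → 0r ≤ y → 0r ≤ x * y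
    sup : (P : ℝ → Set) → ∃ P → ∃ (λ b → ∀ x → P x → x ≤ b) →
          ∃ (λ s → (∀ x → P x → x ≤ s) × (∀ b → (∀ x → P x → x ≤ b) → s ≤ b))

module RealMatrices (R : Reals) where
  open Reals R public

  infix 4 _≐_ _≽_
  infixl 7 _·_
  infixl 6 _⊕_ _⊖_
  infixl 8 _⊗_
  infix 9 _ᵀ

  _-_ : ℝ → ℝ → ℝ
  x - y = x + (- y)

  sumF : ∀ n → (Fin n → ℝ) → ℝ
  sumF zero    f = 0r
  sumF (suc n) f = f Fin.zero + sumF n (λ i → f (Fin.suc i))

  Mat : ℕ → ℕ → Set
  Mat m n = Fin m → Fin n → ℝ

  _≐_ : ∀ {m n} → Mat m n → Mat m n → Set
  A ≐ B = ∀ i j → A i j ≡ B i j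

  _ᵀ : ∀ {m n} → Mat m n → Mat n m
  (A ᵀ) i j = A j i

  _⊕_ : ∀ {m n} → Mat m n → Mat m n → Mat m n
  (A ⊕ B) i j = A i j + B i j

  _⊖_ : ∀ {m n} → Mat m n → Mat m n → Mat m n
  (A ⊖ B) i j = A i j - B i j

  _·_ : ∀ {m k n} → Mat m k → Mat k n → Mat m n
  _·_ {k = k} A B i j = sumF k (λ l → A i l * B l j)

  δ : ∀ {n} → Fin n → Fin n → ℝ
  δ i j = if ⌊ i Fin.≟ j ⌋ then 1r else 0r

  I : ∀ n → Mat n n
  I n = δ

  Jmat : ∀ n (p : ℕ) → Mat n n
  Jmat n p i j = if ⌊ i Fin.≟ j ⌋
                   then (if ⌊ suc (toℕ i) ℕ.≤? p ⌋ then 1r else - 1r)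
                   else 0r

  U : ∀ {n} → (Fin 2 → Fin n) → Mat n 2
  U B j i = if ⌊ B i Fin.≟ j ⌋ then 1r else 0r

  sub : ∀ {n} → Mat n n → (Fin 2 → Fin n) → Mat 2 2
  sub A B a b = A (B a) (B b)

  IsJOrth : ∀ {n} → Mat n n → Mat n n → Set
  IsJOrth M V = ((V ᵀ) · M) · V ≐ M

  frob² : ∀ {m n} → Mat m n → ℝ
  frob² {m} {n} A = sumF m (λ i → sumF n (λ j → A i j * A i j))

  -- vec: column stacking; vec(Y)_{j*m + i} = Y_{ij}
  vec : ∀ {m n} → Mat m n → Fin (n ℕ.* m) → ℝ
  vec {m} {n} Y k with remQuot {n} m k
  ... | j , i = Y i j

  quadForm : ∀ N → Mat N N → (Fin N → ℝ) → ℝ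
  quadForm N M x = sumF N (λ k → sumF N (λ l → x k * M k l * x l))

  norm² : ∀ {m n} → Mat m n → Mat (n ℕ.* m) (n ℕ.* m) → ℝ
  norm² {m} {n} Y M = quadForm (n ℕ.* m) M (vec Y)

  _⊗_ : ∀ {p q r s} → Mat p q → Mat r s → Mat (p ℕ.* r) (q ℕ.* s)
  _⊗_ {p} {q} {r} {s} A B k l with remQuot {p} r k | remQuot {q} s l
  ... | i , a | j , b = A i j * B a b

  Symmetric : ∀ {N} → Mat N N → Set
  Symmetric M = ∀ i j → M i j ≡ M j i

  PSD : ∀ {N} → Mat N N → Set
  PSD {N} M = ∀ x → 0r ≤ quadForm N M x

  _≽_ : ∀ {N} → Mat N N → Mat N N → Set
  A ≽ B = PSD (A ⊖ B)

  Xplus : ∀ {n} → (Fin 2 → Fin n) → Mat n n → Mat 2 2 → Mat n n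
  Xplus B X V = X ⊕ ((U B · (V ⊖ I 2)) · ((U B ᵀ) · X))

{-# OPTIONS --safe #-}
module Submission where

-- With Z = U_Bᵀ X (the rows B₁, B₂ of X), the update X⁺ = X + U_B (V − I) Z changes
-- only the rows B₁, B₂ of X, replacing them by the rows of V Z.
-- (a) For diagonal J, X⁺ᵀ J X⁺ is a sum over rows: the rows outside B contribute as
--     for X, and the rows in B contribute Zᵀ (Vᵀ J_BB V) Z = Zᵀ J_BB Z, again as for X.
-- (b) U_B has orthonormal columns, so ‖X⁺ − X‖_F = ‖(V − I) Z‖_F; Cauchy–Schwarz bounds
--     this by ‖V − I‖_F ‖Z‖_F, and ‖Z‖_F ≤ ‖X‖_F.
-- (c) vec(X⁺ − X) = (Zᵀ ⊗ U_B) vec(V − I), so ‖X⁺ − X‖²_H = ‖V − I‖²_Q̲ ≤ ‖V − I‖²_Q.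

open import Defs
open import Data.Nat as ℕ using (ℕ)
open import Data.Fin using (Fin; zero; suc)
open import Data.Product using (_×_)
open import Relation.Binary.PropositionalEquality using (_≢_)

open import Level using (0ℓ)
open import Algebra.Bundles using (CommutativeRing)
open import Data.Fin as Fin using (combine; remQuot; _↑ˡ_; _↑ʳ_)
open import Data.Fin.Properties using (remQuot-combine; combine-remQuot)
open import Data.Product using (_,_; uncurry)
open import Data.Sum using (_⊎_; inj₁; inj₂)
open import Relation.Binary.Bundles using (Setoid; Poset)
open import Relation.Binary.PropositionalEquality
  using (_≡_; refl; sym; trans; cong; cong₂; subst; subst₂; module ≡-Reasoning)
open import Relation.Binary.Structures using (IsTotalOrder)
open import Relation.Nullary using (yes; no; contradiction)
import Relation.Binary.Reasoning.PartialOrder as PosetReasoning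
import Relation.Binary.Reasoning.Setoid as SetoidReasoning

module RealMatrixAlgebra (R : Reals) where
  open RealMatrices R

  commutativeRing : CommutativeRing 0ℓ 0ℓ
  commutativeRing = record { isCommutativeRing = isCommutativeRing }

  open CommutativeRing commutativeRing
    using ( +-comm; +-assoc; +-identityˡ; +-identityʳ; -‿inverseˡ; -‿inverseʳ
          ; *-comm; *-assoc; *-identityˡ; zeroˡ; zeroʳ; distribˡ
          ; ring; commutativeSemiring )
  open import Algebra.Properties.Ring ring
    using ( -0#≈0#; +-cancelʳ; -‿involutive; -‿+-comm; xyx⁻¹≈y
          ; -‿distribˡ-*; -‿distribʳ-*; x[y-z]≈xy-xz; [y-z]x≈yx-zx )
  open import Algebra.Solver.Ring.NaturalCoefficients.Default commutativeSemiring
    using (solve; _:+_; _:*_; _:=_)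
  open IsTotalOrder isTotalOrder
    using (isPartialOrder; total)
    renaming (refl to ≤-refl; reflexive to ≤-reflexive; trans to ≤-trans)

  ≤-poset : Poset 0ℓ 0ℓ 0ℓ
  ≤-poset = record { isPartialOrder = isPartialOrder }

  module ≤-Reasoning = PosetReasoning ≤-poset

  +-monoʳ-≤ : ∀ z {x y} → x ≤ y → z + x ≤ z + y
  +-monoʳ-≤ z {x} {y} x≤y = subst₂ _≤_ (+-comm x z) (+-comm y z) (+-monoˡ-≤ z x≤y)

  +-mono-≤ : ∀ {x y u v} → x ≤ y → u ≤ v → x + u ≤ y + v
  +-mono-≤ {y = y} {u} x≤y u≤v = ≤-trans (+-monoˡ-≤ u x≤y) (+-monoʳ-≤ y u≤v)

  x≤y+x : ∀ x {y} → 0r ≤ y → x ≤ y + x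
  x≤y+x x {y} 0≤y = subst (_≤ y + x) (+-identityˡ x) (+-monoˡ-≤ x 0≤y)

  x≤y⇒0≤y-x : ∀ {x y} → x ≤ y → 0r ≤ y - x
  x≤y⇒0≤y-x {x} {y} x≤y = subst (_≤ y - x) (-‿inverseʳ x) (+-monoˡ-≤ (- x) x≤y)

  0≤y-x⇒x≤y : ∀ {x y} → 0r ≤ y - x → x ≤ y
  0≤y-x⇒x≤y {x} {y} 0≤y-x = subst₂ _≤_ (+-identityˡ x) y-x+x≡y (+-monoˡ-≤ x 0≤y-x)
    where
    open ≡-Reasoning
    y-x+x≡y : y - x + x ≡ y
    y-x+x≡y = begin
      y + - x + x   ≡⟨ +-assoc y (- x) x ⟩
      y + (- x + x) ≡⟨ cong (y +_) (-‿inverseˡ x) ⟩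
      y + 0r        ≡⟨ +-identityʳ y ⟩
      y             ∎

  x+[y-x]≡y : ∀ x y → x + (y - x) ≡ y
  x+[y-x]≡y x y = trans (sym (+-assoc x y (- x))) (xyx⁻¹≈y x y)

  -x*-x≡x*x : ∀ x → - x * - x ≡ x * x
  -x*-x≡x*x x = begin
    - x * - x     ≡⟨ -‿distribˡ-* x (- x) ⟨
    - (x * - x)   ≡⟨ cong -_ (-‿distribʳ-* x x) ⟨
    - - (x * x)   ≡⟨ -‿involutive (x * x) ⟩
    x * x         ∎
    where open ≡-Reasoning

  square-nonneg : ∀ x → 0r ≤ x * x
  square-nonneg x with total 0r x
  ... | inj₁ 0≤x = *-nonneg 0≤x 0≤x
  ... | inj₂ x≤0 = subst (0r ≤_) (-x*-x≡x*x x) (*-nonneg 0≤-x 0≤-x)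
    where
    0≤-x : 0r ≤ - x
    0≤-x = subst (0r ≤_) (+-identityˡ (- x)) (x≤y⇒0≤y-x x≤0)

  *-monoˡ-≤ : ∀ {c x y} → 0r ≤ c → x ≤ y → c * x ≤ c * y
  *-monoˡ-≤ {c} {x} {y} 0≤c x≤y =
    0≤y-x⇒x≤y (subst (0r ≤_) (x[y-z]≈xy-xz c y x) (*-nonneg 0≤c (x≤y⇒0≤y-x x≤y)))

  x*y+x*y≤x*x+y*y : ∀ x y → x * y + x * y ≤ x * x + y * y
  x*y+x*y≤x*x+y*y x y =
    subst (x * y + x * y ≤_) expand (x≤y+x (x * y + x * y) (square-nonneg (x - y)))
    where
    open ≡-Reasoning
    -- The solver works over the commutative semiring, so - y is an atom, cancelled by hand.
    expand : (x - y) * (x - y) + (x * y + x * y) ≡ x * x + y * y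
    expand = begin
      (x - y) * (x - y) + (x * y + x * y)
        ≡⟨ solve 3 (λ x y m → (x :+ m) :* (x :+ m) :+ (x :* y :+ x :* y)
                             := x :* x :+ m :* m :+ (x :+ x) :* (m :+ y)) refl x y (- y) ⟩
      x * x + - y * - y + (x + x) * (- y + y)
        ≡⟨ cong₂ (λ a b → x * x + a + (x + x) * b) (-x*-x≡x*x y) (-‿inverseˡ y) ⟩
      x * x + y * y + (x + x) * 0r
        ≡⟨ cong (x * x + y * y +_) (zeroʳ (x + x)) ⟩
      x * x + y * y + 0r
        ≡⟨ +-identityʳ _ ⟩
      x * x + y * y ∎

  sumF-cong : ∀ n {f g : Fin n → ℝ} → (∀ i → f i ≡ g i) → sumF n f ≡ sumF n g
  sumF-cong ℕ.zero    f≡g = refl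
  sumF-cong (ℕ.suc n) f≡g = cong₂ _+_ (f≡g zero) (sumF-cong n (λ i → f≡g (suc i)))

  sumF-zero : ∀ n {f : Fin n → ℝ} → (∀ i → f i ≡ 0r) → sumF n f ≡ 0r
  sumF-zero ℕ.zero    f≡0 = refl
  sumF-zero (ℕ.suc n) f≡0 =
    trans (cong₂ _+_ (f≡0 zero) (sumF-zero n (λ i → f≡0 (suc i)))) (+-identityʳ 0r)

  sumF-+ : ∀ n (f g : Fin n → ℝ) → sumF n (λ i → f i + g i) ≡ sumF n f + sumF n g
  sumF-+ ℕ.zero    f g = sym (+-identityʳ 0r)
  sumF-+ (ℕ.suc n) f g =
    trans (cong (f zero + g zero +_) (sumF-+ n (λ i → f (suc i)) (λ i → g (suc i))))
          (solve 4 (λ a b c d → (a :+ b) :+ (c :+ d) := (a :+ c) :+ (b :+ d))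
                 refl (f zero) (g zero) _ _)

  sumF-neg : ∀ n (f : Fin n → ℝ) → sumF n (λ i → - f i) ≡ - sumF n f
  sumF-neg ℕ.zero    f = sym -0#≈0#
  sumF-neg (ℕ.suc n) f =
    trans (cong (- f zero +_) (sumF-neg n (λ i → f (suc i)))) (-‿+-comm _ _)

  sumF-sub : ∀ n (f g : Fin n → ℝ) → sumF n (λ i → f i - g i) ≡ sumF n f - sumF n g
  sumF-sub n f g = trans (sumF-+ n f (λ i → - g i)) (cong (sumF n f +_) (sumF-neg n g))

  sumF-*ˡ : ∀ n c (f : Fin n → ℝ) → c * sumF n f ≡ sumF n (λ i → c * f i)
  sumF-*ˡ ℕ.zero    c f = zeroʳ c
  sumF-*ˡ (ℕ.suc n) c f =
    trans (distribˡ c (f zero) _) (cong (c * f zero +_) (sumF-*ˡ n c (λ i → f (suc i))))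

  sumF-*ʳ : ∀ n c (f : Fin n → ℝ) → sumF n f * c ≡ sumF n (λ i → f i * c)
  sumF-*ʳ n c f =
    trans (*-comm _ c) (trans (sumF-*ˡ n c f) (sumF-cong n (λ i → *-comm c (f i))))

  sumF-swap : ∀ m n (f : Fin m → Fin n → ℝ) →
    sumF m (λ i → sumF n (f i)) ≡ sumF n (λ j → sumF m (λ i → f i j))
  sumF-swap ℕ.zero    n f = sym (sumF-zero n (λ _ → refl))
  sumF-swap (ℕ.suc m) n f =
    trans (cong (sumF n (f zero) +_) (sumF-swap m n (λ i → f (suc i))))
          (sym (sumF-+ n (f zero) (λ j → sumF m (λ i → f (suc i) j))))

  sumF-*-sumF : ∀ m n (f : Fin m → ℝ) (g : Fin n → ℝ) →
    sumF m f * sumF n g ≡ sumF m (λ i → sumF n (λ j → f i * g j))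
  sumF-*-sumF m n f g =
    trans (sumF-*ʳ m (sumF n g) f) (sumF-cong m (λ i → sumF-*ˡ n (f i) g))

  sumF-*-sumF-assoc : ∀ m n (a : Fin m → ℝ) (b : Fin m → Fin n → ℝ) (c : Fin n → ℝ) →
    sumF m (λ k → a k * sumF n (λ l → b k l * c l))
      ≡ sumF n (λ l → sumF m (λ k → a k * b k l) * c l)
  sumF-*-sumF-assoc m n a b c = begin
    sumF m (λ k → a k * sumF n (λ l → b k l * c l))
      ≡⟨ sumF-cong m (λ k → sumF-*ˡ n (a k) _) ⟩
    sumF m (λ k → sumF n (λ l → a k * (b k l * c l)))
      ≡⟨ sumF-swap m n _ ⟩
    sumF n (λ l → sumF m (λ k → a k * (b k l * c l)))
      ≡⟨ sumF-cong n (λ l → sumF-cong m (λ k → *-assoc (a k) (b k l) (c l))) ⟨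
    sumF n (λ l → sumF m (λ k → a k * b k l * c l))
      ≡⟨ sumF-cong n (λ l → sumF-*ʳ m (c l) _) ⟨
    sumF n (λ l → sumF m (λ k → a k * b k l) * c l) ∎
    where open ≡-Reasoning

  sumF-single : ∀ n (f : Fin n → ℝ) k → (∀ i → i ≢ k → f i ≡ 0r) → sumF n f ≡ f k
  sumF-single (ℕ.suc n) f zero    f≡0 =
    trans (cong (f zero +_) (sumF-zero n (λ i → f≡0 (suc i) (λ ())))) (+-identityʳ _)
  sumF-single (ℕ.suc n) f (suc k) f≡0 =
    trans (cong₂ _+_ (f≡0 zero (λ ())) (sumF-single n (λ i → f (suc i)) k
                                          (λ i i≢k → f≡0 (suc i) (λ { refl → i≢k refl }))))
          (+-identityˡ _)

  sumF-mono : ∀ n {f g : Fin n → ℝ} → (∀ i → f i ≤ g i) → sumF n f ≤ sumF n g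
  sumF-mono ℕ.zero    f≤g = ≤-refl
  sumF-mono (ℕ.suc n) f≤g = +-mono-≤ (f≤g zero) (sumF-mono n (λ i → f≤g (suc i)))

  sumF-nonneg : ∀ n {f : Fin n → ℝ} → (∀ i → 0r ≤ f i) → 0r ≤ sumF n f
  sumF-nonneg n {f} 0≤f = subst (_≤ sumF n f) (sumF-zero n (λ _ → refl)) (sumF-mono n 0≤f)

  sumF-↑ : ∀ m n (f : Fin (m ℕ.+ n) → ℝ) →
    sumF (m ℕ.+ n) f ≡ sumF m (λ i → f (i ↑ˡ n)) + sumF n (λ j → f (m ↑ʳ j))
  sumF-↑ ℕ.zero    n f = sym (+-identityˡ _)
  sumF-↑ (ℕ.suc m) n f =
    trans (cong (f zero +_) (sumF-↑ m n (λ i → f (suc i)))) (sym (+-assoc _ _ _))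

  sumF-combine : ∀ m n (f : Fin (m ℕ.* n) → ℝ) →
    sumF (m ℕ.* n) f ≡ sumF m (λ i → sumF n (λ j → f (combine i j)))
  sumF-combine ℕ.zero    n f = refl
  sumF-combine (ℕ.suc m) n f =
    trans (sumF-↑ n (m ℕ.* n) f)
          (cong (sumF n (λ j → f (combine {ℕ.suc m} zero j)) +_)
                (sumF-combine m n (λ k → f (n ↑ʳ k))))

  sumF-linear : ∀ n c d (f g : Fin n → ℝ) →
    sumF n (λ i → c * f i + d * g i) ≡ c * sumF n f + d * sumF n g
  sumF-linear n c d f g =
    trans (sumF-+ n _ _) (sym (cong₂ _+_ (sumF-*ˡ n c f) (sumF-*ˡ n d g)))

  cauchy-schwarz : ∀ n (a b : Fin n → ℝ) →
    sumF n (λ i → a i * b i) * sumF n (λ i → a i * b i)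
      ≤ sumF n (λ i → a i * a i) * sumF n (λ i → b i * b i)
  cauchy-schwarz ℕ.zero    a b = ≤-refl
  cauchy-schwarz (ℕ.suc n) a b = begin
    (a₀ * b₀ + P) * (a₀ * b₀ + P)
      ≡⟨ solve 2 (λ c P → (c :+ P) :* (c :+ P) := c :* c :+ ((c :* P :+ c :* P) :+ P :* P))
               refl (a₀ * b₀) P ⟩
    a₀ * b₀ * (a₀ * b₀) + ((a₀ * b₀ * P + a₀ * b₀ * P) + P * P)
      ≤⟨ +-monoʳ-≤ _ (+-mono-≤ cross (cauchy-schwarz n a′ b′)) ⟩
    a₀ * b₀ * (a₀ * b₀) + ((a₀ * a₀ * Sb + b₀ * b₀ * Sa) + Sa * Sb)
      ≡⟨ solve 4 (λ a₀ b₀ Sa Sb →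
                    a₀ :* b₀ :* (a₀ :* b₀) :+ ((a₀ :* a₀ :* Sb :+ b₀ :* b₀ :* Sa) :+ Sa :* Sb)
                    := (a₀ :* a₀ :+ Sa) :* (b₀ :* b₀ :+ Sb))
               refl a₀ b₀ Sa Sb ⟩
    (a₀ * a₀ + Sa) * (b₀ * b₀ + Sb) ∎
    where
    open ≤-Reasoning
    a₀ = a zero
    b₀ = b zero
    a′ b′ : Fin n → ℝ
    a′ i = a (suc i)
    b′ i = b (suc i)
    P  = sumF n (λ i → a′ i * b′ i)
    Sa = sumF n (λ i → a′ i * a′ i)
    Sb = sumF n (λ i → b′ i * b′ i)
    -- Summing AM-GM for a₀ b′ᵢ and b₀ a′ᵢ.
    cross : a₀ * b₀ * P + a₀ * b₀ * P ≤ a₀ * a₀ * Sb + b₀ * b₀ * Sa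
    cross = subst₂ _≤_
      (trans (sumF-cong n (λ i → cong₂ _+_ (mixed i) (mixed i))) (sumF-linear n _ _ _ _))
      (trans (sumF-cong n (λ i → cong₂ _+_ (square a₀ b′ i) (square b₀ a′ i)))
             (sumF-linear n _ _ _ _))
      (sumF-mono n (λ i → x*y+x*y≤x*x+y*y (a₀ * b′ i) (b₀ * a′ i)))
      where
      mixed : ∀ i → a₀ * b′ i * (b₀ * a′ i) ≡ a₀ * b₀ * (a′ i * b′ i)
      mixed i = solve 4 (λ a₀ b₀ a b → a₀ :* b :* (b₀ :* a) := a₀ :* b₀ :* (a :* b))
                        refl a₀ b₀ (a′ i) (b′ i)
      square : ∀ c (f : Fin n → ℝ) i → c * f i * (c * f i) ≡ c * c * (f i * f i)
      square c f i = solve 2 (λ c x → c :* x :* (c :* x) := c :* c :* (x :* x)) refl c (f i)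

  ≐-setoid : ℕ → ℕ → Setoid 0ℓ 0ℓ
  ≐-setoid m n = record
    { Carrier       = Mat m n
    ; _≈_           = _≐_
    ; isEquivalence = record
      { refl  = λ i j → refl
      ; sym   = λ A≐B i j → sym (A≐B i j)
      ; trans = λ A≐B B≐C i j → trans (A≐B i j) (B≐C i j)
      }
    }

  δ-diag : ∀ {n} (i : Fin n) → δ i i ≡ 1r
  δ-diag i with i Fin.≟ i
  ... | yes _   = refl
  ... | no i≢i = contradiction refl i≢i

  δ-offdiag : ∀ {n} {i j : Fin n} → i ≢ j → δ i j ≡ 0r
  δ-offdiag {i = i} {j} i≢j with i Fin.≟ j
  ... | yes i≡j = contradiction i≡j i≢j
  ... | no _    = refl

  sumF-δ : ∀ n (k : Fin n) (f : Fin n → ℝ) → sumF n (λ i → δ k i * f i) ≡ f k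
  sumF-δ n k f =
    trans (sumF-single n _ k δf-offdiag) (trans (cong (_* f k) (δ-diag k)) (*-identityˡ (f k)))
    where
    δf-offdiag : ∀ i → i ≢ k → δ k i * f i ≡ 0r
    δf-offdiag i i≢k = trans (cong (_* f i) (δ-offdiag (λ k≡i → i≢k (sym k≡i)))) (zeroˡ (f i))

  ·-congˡ : ∀ {m k n} {A A′ : Mat m k} (B : Mat k n) → A ≐ A′ → A · B ≐ A′ · B
  ·-congˡ {k = k} B A≐A′ i j = sumF-cong k (λ l → cong (_* B l j) (A≐A′ i l))

  ·-congʳ : ∀ {m k n} (A : Mat m k) {B B′ : Mat k n} → B ≐ B′ → A · B ≐ A · B′
  ·-congʳ {k = k} A B≐B′ i j = sumF-cong k (λ l → cong (A i l *_) (B≐B′ l j))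

  ·-assoc : ∀ {m k l n} (A : Mat m k) (B : Mat k l) (C : Mat l n) → (A · B) · C ≐ A · (B · C)
  ·-assoc {k = k} {l} A B C i j = sym (sumF-*-sumF-assoc k l (A i) B (λ t → C t j))

  ᵀ-· : ∀ {m k n} (A : Mat m k) (B : Mat k n) → (A · B) ᵀ ≐ B ᵀ · A ᵀ
  ᵀ-· {k = k} A B i j = sumF-cong k (λ l → *-comm (A j l) (B l i))

  ·-identityˡ : ∀ {m n} (A : Mat m n) → I m · A ≐ A
  ·-identityˡ {m} A i j = sumF-δ m i (λ l → A l j)

  ·-distribʳ-⊖ : ∀ {m k n} (A B : Mat m k) (C : Mat k n) → (A ⊖ B) · C ≐ A · C ⊖ B · C
  ·-distribʳ-⊖ {k = k} A B C i j =
    trans (sumF-cong k (λ l → [y-z]x≈yx-zx (C l j) (A i l) (B i l))) (sumF-sub k _ _)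

  frob²-cong : ∀ {m n} {A B : Mat m n} → A ≐ B → frob² A ≡ frob² B
  frob²-cong {m} {n} A≐B =
    sumF-cong m (λ i → sumF-cong n (λ j → cong₂ _*_ (A≐B i j) (A≐B i j)))

  frob²-nonneg : ∀ {m n} (A : Mat m n) → 0r ≤ frob² A
  frob²-nonneg {m} {n} A = sumF-nonneg m (λ i → sumF-nonneg n (λ j → square-nonneg (A i j)))

  frob²-·-≤ : ∀ {m k n} (A : Mat m k) (Z : Mat k n) → frob² (A · Z) ≤ frob² A * frob² Z
  frob²-·-≤ {m} {k} {n} A Z = begin
    frob² (A · Z)
      ≤⟨ sumF-mono m (λ i → sumF-mono n (λ j → cauchy-schwarz k (A i) (λ l → Z l j))) ⟩
    sumF m (λ i → sumF n (λ j → sumF k (λ l → A i l * A i l) * sumF k (λ l → Z l j * Z l j)))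
      ≡⟨ sumF-*-sumF m n _ _ ⟨
    frob² A * sumF n (λ j → sumF k (λ l → Z l j * Z l j))
      ≡⟨ cong (frob² A *_) (sumF-swap n k _) ⟩
    frob² A * frob² Z ∎
    where open ≤-Reasoning

  Diagonal : ∀ {n} → Mat n n → Set
  Diagonal M = ∀ i j → i ≢ j → M i j ≡ 0r

  Jmat-diagonal : ∀ n p → Diagonal (Jmat n p)
  Jmat-diagonal n p i j i≢j with i Fin.≟ j
  ... | yes i≡j = contradiction i≡j i≢j
  ... | no _    = refl

  diagonal-form : ∀ {n k} {M : Mat n n} → Diagonal M → (P Q : Mat n k) → ∀ r t →
    ((P ᵀ · M) · Q) r t ≡ sumF n (λ l → M l l * (P l r * Q l t))
  diagonal-form {n} {M = M} diagonal P Q r t = sumF-cong n column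
    where
    open ≡-Reasoning
    column : ∀ l → sumF n (λ m → P m r * M m l) * Q l t ≡ M l l * (P l r * Q l t)
    column l = begin
      sumF n (λ m → P m r * M m l) * Q l t
        ≡⟨ cong (_* Q l t) (sumF-single n _ l (λ m m≢l → trans (cong (P m r *_) (diagonal m l m≢l))
                                                                (zeroʳ _))) ⟩
      P l r * M l l * Q l t
        ≡⟨ solve 3 (λ x d y → x :* d :* y := d :* (x :* y)) refl (P l r) (M l l) (Q l t) ⟩
      M l l * (P l r * Q l t) ∎

  IsJOrth-preserves-form : ∀ {k n} {S V : Mat k k} → IsJOrth S V → (Z : Mat k n) →
    ((V · Z) ᵀ · S) · (V · Z) ≐ (Z ᵀ · S) · Z
  IsJOrth-preserves-form {S = S} {V} VᵀSV≐S Z = begin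
    ((V · Z) ᵀ · S) · (V · Z)    ≈⟨ ·-congˡ (V · Z) (·-congˡ S (ᵀ-· V Z)) ⟩
    ((Z ᵀ · V ᵀ) · S) · (V · Z)  ≈⟨ ·-congˡ (V · Z) (·-assoc (Z ᵀ) (V ᵀ) S) ⟩
    (Z ᵀ · (V ᵀ · S)) · (V · Z)  ≈⟨ ·-assoc (Z ᵀ) (V ᵀ · S) (V · Z) ⟩
    Z ᵀ · ((V ᵀ · S) · (V · Z))  ≈⟨ ·-congʳ (Z ᵀ) (·-assoc (V ᵀ · S) V Z) ⟨
    Z ᵀ · (((V ᵀ · S) · V) · Z)  ≈⟨ ·-congʳ (Z ᵀ) (·-congˡ Z VᵀSV≐S) ⟩
    Z ᵀ · (S · Z)                ≈⟨ ·-assoc (Z ᵀ) S Z ⟨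
    (Z ᵀ · S) · Z                ∎
    where open SetoidReasoning (≐-setoid _ _)

  infixr 8 _·ᵥ_
  infix  7 _∙_

  _·ᵥ_ : ∀ {m n} → Mat m n → (Fin n → ℝ) → Fin m → ℝ
  (_·ᵥ_ {n = n} M v) i = sumF n (λ j → M i j * v j)

  _∙_ : ∀ {n} → (Fin n → ℝ) → (Fin n → ℝ) → ℝ
  _∙_ {n} u w = sumF n (λ i → u i * w i)

  ∙-congʳ : ∀ {n} (u : Fin n → ℝ) {w w′ : Fin n → ℝ} →
    (∀ i → w i ≡ w′ i) → u ∙ w ≡ u ∙ w′
  ∙-congʳ {n} u w≡w′ = sumF-cong n (λ i → cong (u i *_) (w≡w′ i))

  ·ᵥ-assoc : ∀ {m k n} (M : Mat m k) (K : Mat k n) v i → (M ·ᵥ K ·ᵥ v) i ≡ ((M · K) ·ᵥ v) i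
  ·ᵥ-assoc {k = k} {n} M K v i = sumF-*-sumF-assoc k n (M i) K v

  ·ᵥ-adjoint : ∀ {m n} (K : Mat m n) v w → K ·ᵥ v ∙ w ≡ v ∙ K ᵀ ·ᵥ w
  ·ᵥ-adjoint {m} {n} K v w = begin
    sumF m (λ k → (K ·ᵥ v) k * w k)
      ≡⟨ sumF-cong m (λ k → *-comm _ (w k)) ⟩
    sumF m (λ k → w k * (K ·ᵥ v) k)
      ≡⟨ sumF-*-sumF-assoc m n w K v ⟩
    sumF n (λ c → sumF m (λ k → w k * K k c) * v c)
      ≡⟨ sumF-cong n (λ c → *-comm _ (v c)) ⟩
    sumF n (λ c → v c * sumF m (λ k → w k * K k c))
      ≡⟨ ∙-congʳ v (λ c → sumF-cong m (λ k → *-comm (w k) (K k c))) ⟩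
    v ∙ K ᵀ ·ᵥ w ∎
    where open ≡-Reasoning

  quadForm-∙ : ∀ N (M : Mat N N) x → quadForm N M x ≡ x ∙ M ·ᵥ x
  quadForm-∙ N M x = sumF-cong N (λ k →
    trans (sumF-cong N (λ l → *-assoc (x k) (M k l) (x l))) (sym (sumF-*ˡ N (x k) _)))

  quadForm-cong : ∀ N (M : Mat N N) {x y : Fin N → ℝ} → (∀ k → x k ≡ y k) →
    quadForm N M x ≡ quadForm N M y
  quadForm-cong N M x≡y =
    sumF-cong N (λ k → sumF-cong N (λ l → cong₂ (λ a b → a * M k l * b) (x≡y k) (x≡y l)))

  quadForm-·ᵥ : ∀ N m (M : Mat N N) (K : Mat N m) v →
    quadForm N M (K ·ᵥ v) ≡ quadForm m (K ᵀ · (M · K)) v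
  quadForm-·ᵥ N m M K v = begin
    quadForm N M (K ·ᵥ v)       ≡⟨ quadForm-∙ N M (K ·ᵥ v) ⟩
    K ·ᵥ v ∙ M ·ᵥ K ·ᵥ v        ≡⟨ ∙-congʳ (K ·ᵥ v) (·ᵥ-assoc M K v) ⟩
    K ·ᵥ v ∙ (M · K) ·ᵥ v       ≡⟨ ·ᵥ-adjoint K v ((M · K) ·ᵥ v) ⟩
    v ∙ K ᵀ ·ᵥ (M · K) ·ᵥ v     ≡⟨ ∙-congʳ v (·ᵥ-assoc (K ᵀ) (M · K) v) ⟩
    v ∙ (K ᵀ · (M · K)) ·ᵥ v    ≡⟨ quadForm-∙ m (K ᵀ · (M · K)) v ⟨
    quadForm m (K ᵀ · (M · K)) v ∎
    where open ≡-Reasoning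

  quadForm-⊖ : ∀ N (A B : Mat N N) x →
    quadForm N (A ⊖ B) x ≡ quadForm N A x - quadForm N B x
  quadForm-⊖ N A B x =
    trans (sumF-cong N (λ k → trans (sumF-cong N (entry k)) (sumF-sub N _ _))) (sumF-sub N _ _)
    where
    entry : ∀ k l → x k * (A ⊖ B) k l * x l ≡ (x k * A k l * x l) - (x k * B k l * x l)
    entry k l = trans (cong (_* x l) (x[y-z]≈xy-xz (x k) (A k l) (B k l)))
                      ([y-z]x≈yx-zx (x l) (x k * A k l) (x k * B k l))

  ≽⇒quadForm-≤ : ∀ {N} {A B : Mat N N} → A ≽ B → ∀ x → quadForm N B x ≤ quadForm N A x
  ≽⇒quadForm-≤ {N} {A} {B} A≽B x = 0≤y-x⇒x≤y (subst (0r ≤_) (quadForm-⊖ N A B x) (A≽B x))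

  vec-cong : ∀ {m n} {A B : Mat m n} → A ≐ B → ∀ k → vec A k ≡ vec B k
  vec-cong A≐B k = A≐B _ _

  vec-combine : ∀ {m n} (A : Mat m n) j i → vec A (combine j i) ≡ A i j
  vec-combine A j i = cong (uncurry λ j′ i′ → A i′ j′) (remQuot-combine j i)

  ⊗-combine : ∀ {p q r s} (P : Mat p q) (L : Mat r s) j i b a →
    (P ⊗ L) (combine j i) (combine b a) ≡ P j b * L i a
  ⊗-combine P L j i b a = cong₂ (λ (j′ , i′) (b′ , a′) → P j′ b′ * L i′ a′)
                                (remQuot-combine j i) (remQuot-combine b a)

  vec-·-· : ∀ {m p q n} (L : Mat m p) (A : Mat p q) (C : Mat q n) k →
    vec ((L · A) · C) k ≡ ((C ᵀ ⊗ L) ·ᵥ vec A) k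
  vec-·-· {m} {p} {q} {n} L A C k =
    subst (λ k → vec ((L · A) · C) k ≡ ((C ᵀ ⊗ L) ·ᵥ vec A) k)
          (combine-remQuot {n} m k) (at-combine (remQuot {n} m k))
    where
    open ≡-Reasoning
    at-combine : ∀ ji →
      vec ((L · A) · C) (uncurry combine ji) ≡ ((C ᵀ ⊗ L) ·ᵥ vec A) (uncurry combine ji)
    at-combine (j , i) = begin
      vec ((L · A) · C) (combine j i)
        ≡⟨ vec-combine ((L · A) · C) j i ⟩
      sumF q (λ b → sumF p (λ a → L i a * A a b) * C b j)
        ≡⟨ sumF-cong q (λ b → sumF-*ʳ p (C b j) _) ⟩
      sumF q (λ b → sumF p (λ a → L i a * A a b * C b j))
        ≡⟨ sumF-cong q (λ b → sumF-cong p (λ a → entry b a)) ⟩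
      sumF q (λ b → sumF p (λ a → (C ᵀ ⊗ L) (combine j i) (combine b a) * vec A (combine b a)))
        ≡⟨ sumF-combine q p _ ⟨
      ((C ᵀ ⊗ L) ·ᵥ vec A) (combine j i) ∎
      where
      entry : ∀ b a →
        L i a * A a b * C b j ≡ (C ᵀ ⊗ L) (combine j i) (combine b a) * vec A (combine b a)
      entry b a = sym (trans (cong₂ _*_ (⊗-combine (C ᵀ) L j i b a) (vec-combine A b a))
        (solve 3 (λ c l x → c :* l :* x := l :* x :* c) refl (C b j) (L i a) (A a b)))


  module _ {n} (B : Fin 2 → Fin n) where

    OutsideImage : Fin n → Set
    OutsideImage i = ∀ a → B a ≢ i

    imageIndicator : Fin n → ℝ
    imageIndicator i = sumF 2 (U B i)

    sumF-imageIndicator : ∀ (f : Fin n → ℝ) →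
      sumF n (λ i → imageIndicator i * f i) ≡ sumF 2 (λ a → f (B a))
    sumF-imageIndicator f = begin
      sumF n (λ i → imageIndicator i * f i)       ≡⟨ sumF-cong n (λ i → sumF-*ʳ 2 (f i) (U B i)) ⟩
      sumF n (λ i → sumF 2 (λ a → U B i a * f i)) ≡⟨ sumF-swap n 2 (λ i a → U B i a * f i) ⟩
      sumF 2 (λ a → sumF n (λ i → U B i a * f i)) ≡⟨ sumF-cong 2 (λ a → sumF-δ n (B a) f) ⟩
      sumF 2 (λ a → f (B a))                       ∎
      where open ≡-Reasoning

    Uᵀ-· : ∀ {k} (M : Mat n k) a j → (U B ᵀ · M) a j ≡ M (B a) j
    Uᵀ-· M a j = sumF-δ n (B a) (λ l → M l j)

    U-·-outside : ∀ {k} (M : Mat 2 k) {i} → OutsideImage i → ∀ j → (U B · M) i j ≡ 0r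
    U-·-outside M outside j =
      sumF-zero 2 (λ a → trans (cong (_* M a j) (δ-offdiag (outside a))) (zeroˡ _))

    Xplus-⊖ : ∀ X V → Xplus B X V ⊖ X ≐ (U B · (V ⊖ I 2)) · (U B ᵀ · X)
    Xplus-⊖ X V i j = xyx⁻¹≈y (X i j) _

    Xplus-norm²-≤ : ∀ X V H Q →
      Q ≽ ((((U B ᵀ) · X) ᵀ ⊗ U B) ᵀ · (H · (((U B ᵀ) · X) ᵀ ⊗ U B))) →
      norm² (Xplus B X V ⊖ X) H ≤ norm² (V ⊖ I 2) Q
    Xplus-norm²-≤ X V H Q Q≽KᵀHK = begin
      norm² (Xplus B X V ⊖ X) H          ≡⟨ quadForm-cong (n ℕ.* n) H vec-D≡K·vec-A ⟩
      quadForm (n ℕ.* n) H (K ·ᵥ vec A)  ≡⟨ quadForm-·ᵥ (n ℕ.* n) 4 H K (vec A) ⟩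
      quadForm 4 (K ᵀ · (H · K)) (vec A) ≤⟨ ≽⇒quadForm-≤ {A = Q} {K ᵀ · (H · K)} Q≽KᵀHK (vec A) ⟩
      norm² A Q                          ∎
      where
      open ≤-Reasoning
      A = V ⊖ I 2
      Z = U B ᵀ · X
      K = Z ᵀ ⊗ U B
      vec-D≡K·vec-A : ∀ k → vec (Xplus B X V ⊖ X) k ≡ (K ·ᵥ vec A) k
      vec-D≡K·vec-A k = trans (vec-cong (Xplus-⊖ X V) k) (vec-·-· (U B) A Z k)

  module _ {n} (B : Fin 2 → Fin n) (B₀≢B₁ : B zero ≢ B (suc zero)) where

    B-injective : ∀ {a b} → B a ≡ B b → a ≡ b
    B-injective {zero}     {zero}     _   = refl
    B-injective {zero}     {suc zero} B≡B = contradiction B≡B B₀≢B₁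
    B-injective {suc zero} {zero}     B≡B = contradiction (sym B≡B) B₀≢B₁
    B-injective {suc zero} {suc zero} _   = refl

    sub-diagonal : ∀ {J : Mat n n} → Diagonal J → Diagonal (sub J B)
    sub-diagonal J-diagonal a b a≢b = J-diagonal (B a) (B b) (λ Ba≡Bb → a≢b (B-injective Ba≡Bb))

    U-·-image : ∀ {k} (M : Mat 2 k) a j → (U B · M) (B a) j ≡ M a j
    U-·-image M a j =
      trans (sumF-single 2 _ a Ub≡0) (trans (cong (_* M a j) (δ-diag (B a))) (*-identityˡ _))
      where
      Ub≡0 : ∀ b → b ≢ a → U B (B a) b * M b j ≡ 0r
      Ub≡0 b b≢a =
        trans (cong (_* M b j) (δ-offdiag (λ Bb≡Ba → b≢a (B-injective Bb≡Ba)))) (zeroˡ _)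

    imageIndicator-cases : ∀ i →
      imageIndicator B i ≡ 1r ⊎ (imageIndicator B i ≡ 0r × OutsideImage B i)
    imageIndicator-cases i with B zero Fin.≟ i | B (suc zero) Fin.≟ i
    ... | yes B₀≡i | yes B₁≡i = contradiction (trans B₀≡i (sym B₁≡i)) B₀≢B₁
    ... | yes _    | no _     = inj₁ (trans (cong (1r +_) (+-identityʳ 0r)) (+-identityʳ 1r))
    ... | no _     | yes _    = inj₁ (trans (+-identityˡ _) (+-identityʳ _))
    ... | no B₀≢i  | no B₁≢i  = inj₂ (trans (+-identityˡ _) (+-identityʳ _) , outside)
      where
      outside : OutsideImage B i
      outside zero       = B₀≢i
      outside (suc zero) = B₁≢i

    imageIndicator-*-outside : ∀ {i} → imageIndicator B i ≡ 0r → ∀ x →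
      imageIndicator B i * x ≡ 0r
    imageIndicator-*-outside χ≡0 x = trans (cong (_* x) χ≡0) (zeroˡ x)

    imageIndicator-*-image : ∀ {i} → imageIndicator B i ≡ 1r → ∀ x →
      imageIndicator B i * x ≡ x
    imageIndicator-*-image χ≡1 x = trans (cong (_* x) χ≡1) (*-identityˡ x)

    sumF-image : ∀ (f : Fin n → ℝ) → (∀ i → OutsideImage B i → f i ≡ 0r) →
      sumF n f ≡ sumF 2 (λ a → f (B a))
    sumF-image f f≡0 = trans (sumF-cong n f≡χf) (sumF-imageIndicator B f)
      where
      f≡χf : ∀ i → f i ≡ imageIndicator B i * f i
      f≡χf i with imageIndicator-cases i
      ... | inj₁ χ≡1             = sym (imageIndicator-*-image χ≡1 (f i))
      ... | inj₂ (χ≡0 , outside) = trans (f≡0 i outside) (sym (imageIndicator-*-outside χ≡0 (f i)))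

    sumF-image-≤ : ∀ (f : Fin n → ℝ) → (∀ i → 0r ≤ f i) →
      sumF 2 (λ a → f (B a)) ≤ sumF n f
    sumF-image-≤ f 0≤f = subst (_≤ sumF n f) (sumF-imageIndicator B f) (sumF-mono n χf≤f)
      where
      χf≤f : ∀ i → imageIndicator B i * f i ≤ f i
      χf≤f i with imageIndicator-cases i
      ... | inj₁ χ≡1       = ≤-reflexive (imageIndicator-*-image χ≡1 (f i))
      ... | inj₂ (χ≡0 , _) = subst (_≤ f i) (sym (imageIndicator-*-outside χ≡0 (f i))) (0≤f i)

    sumF-cong-image : ∀ (f g : Fin n → ℝ) → (∀ i → OutsideImage B i → f i ≡ g i) →
      sumF 2 (λ a → f (B a)) ≡ sumF 2 (λ a → g (B a)) → sumF n f ≡ sumF n g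
    sumF-cong-image f g f≡g-outside f≡g-image = +-cancelʳ (sumF 2 (λ a → g (B a))) _ _ (begin
      sumF n f + sumF 2 (λ a → g (B a))
        ≡⟨ cong (sumF n f +_) (sumF-imageIndicator B g) ⟨
      sumF n f + sumF n (λ i → imageIndicator B i * g i)
        ≡⟨ sumF-+ n _ _ ⟨
      sumF n (λ i → f i + imageIndicator B i * g i)
        ≡⟨ sumF-cong n swapped ⟩
      sumF n (λ i → g i + imageIndicator B i * f i)
        ≡⟨ sumF-+ n _ _ ⟩
      sumF n g + sumF n (λ i → imageIndicator B i * f i)
        ≡⟨ cong (sumF n g +_) (trans (sumF-imageIndicator B f) f≡g-image) ⟩
      sumF n g + sumF 2 (λ a → g (B a)) ∎)
      where
      open ≡-Reasoning
      swapped : ∀ i → f i + imageIndicator B i * g i ≡ g i + imageIndicator B i * f i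
      swapped i with imageIndicator-cases i
      ... | inj₁ χ≡1 = begin
        f i + imageIndicator B i * g i ≡⟨ cong (f i +_) (imageIndicator-*-image χ≡1 (g i)) ⟩
        f i + g i                      ≡⟨ +-comm (f i) (g i) ⟩
        g i + f i                      ≡⟨ cong (g i +_) (imageIndicator-*-image χ≡1 (f i)) ⟨
        g i + imageIndicator B i * f i ∎
      ... | inj₂ (χ≡0 , outside) = cong₂ _+_ (f≡g-outside i outside)
        (trans (imageIndicator-*-outside χ≡0 (g i)) (sym (imageIndicator-*-outside χ≡0 (f i))))

    Xplus-outside : ∀ X V {i} → OutsideImage B i → ∀ j → Xplus B X V i j ≡ X i j
    Xplus-outside X V outside j = trans
      (cong (X _ j +_) (trans (·-assoc (U B) (V ⊖ I 2) (U B ᵀ · X) _ j)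
                              (U-·-outside B ((V ⊖ I 2) · (U B ᵀ · X)) outside j)))
      (+-identityʳ _)

    Xplus-image : ∀ X V a j → Xplus B X V (B a) j ≡ (V · (U B ᵀ · X)) a j
    Xplus-image X V a j = begin
      X (B a) j + ((U B · A) · Z) (B a) j
        ≡⟨ cong₂ _+_ (sym (Uᵀ-· B X a j))
                     (trans (·-assoc (U B) A Z (B a) j) (U-·-image (A · Z) a j)) ⟩
      Z a j + (A · Z) a j
        ≡⟨ cong (Z a j +_) (·-distribʳ-⊖ V (I 2) Z a j) ⟩
      Z a j + ((V · Z) a j - (I 2 · Z) a j)
        ≡⟨ cong (λ z → Z a j + ((V · Z) a j - z)) (·-identityˡ Z a j) ⟩
      Z a j + ((V · Z) a j - Z a j)
        ≡⟨ x+[y-x]≡y (Z a j) ((V · Z) a j) ⟩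
      (V · Z) a j ∎
      where
      open ≡-Reasoning
      A = V ⊖ I 2
      Z = U B ᵀ · X

    Xplus-form-image : ∀ {J : Mat n n} → Diagonal J → ∀ X V → IsJOrth (sub J B) V → ∀ r t →
      sumF 2 (λ a → J (B a) (B a) * (Xplus B X V (B a) r * Xplus B X V (B a) t))
        ≡ sumF 2 (λ a → J (B a) (B a) * (X (B a) r * X (B a) t))
    Xplus-form-image {J} J-diagonal X V VᵀSV≐S r t = begin
      sumF 2 (λ a → S a a * (Xplus B X V (B a) r * Xplus B X V (B a) t))
        ≡⟨ sumF-cong 2 (λ a → weighted (S a a) (Xplus-image X V a r) (Xplus-image X V a t)) ⟩
      sumF 2 (λ a → S a a * ((V · Z) a r * (V · Z) a t))
        ≡⟨ diagonal-form S-diagonal (V · Z) (V · Z) r t ⟨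
      (((V · Z) ᵀ · S) · (V · Z)) r t
        ≡⟨ IsJOrth-preserves-form {S = S} {V} VᵀSV≐S Z r t ⟩
      ((Z ᵀ · S) · Z) r t
        ≡⟨ diagonal-form S-diagonal Z Z r t ⟩
      sumF 2 (λ a → S a a * (Z a r * Z a t))
        ≡⟨ sumF-cong 2 (λ a → weighted (S a a) (Uᵀ-· B X a r) (Uᵀ-· B X a t)) ⟩
      sumF 2 (λ a → S a a * (X (B a) r * X (B a) t)) ∎
      where
      open ≡-Reasoning
      Z = U B ᵀ · X
      S = sub J B
      S-diagonal = sub-diagonal J-diagonal
      weighted : ∀ c {x x′ y y′} → x ≡ x′ → y ≡ y′ → c * (x * y) ≡ c * (x′ * y′)
      weighted c = cong₂ (λ x y → c * (x * y))

    Xplus-IsJOrth : ∀ {J : Mat n n} → Diagonal J → ∀ X V →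
      IsJOrth (sub J B) V → IsJOrth J X → IsJOrth J (Xplus B X V)
    Xplus-IsJOrth {J} J-diagonal X V VᵀSV≐S XᵀJX≐J r t = begin
      ((X⁺ ᵀ · J) · X⁺) r t
        ≡⟨ diagonal-form J-diagonal X⁺ X⁺ r t ⟩
      sumF n (λ l → J l l * (X⁺ l r * X⁺ l t))
        ≡⟨ sumF-cong-image _ _ outside (Xplus-form-image J-diagonal X V VᵀSV≐S r t) ⟩
      sumF n (λ l → J l l * (X l r * X l t))
        ≡⟨ diagonal-form J-diagonal X X r t ⟨
      ((X ᵀ · J) · X) r t
        ≡⟨ XᵀJX≐J r t ⟩
      J r t ∎
      where
      open ≡-Reasoning
      X⁺ = Xplus B X V
      outside : ∀ l → OutsideImage B l → J l l * (X⁺ l r * X⁺ l t) ≡ J l l * (X l r * X l t)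
      outside l out =
        cong₂ (λ x y → J l l * (x * y)) (Xplus-outside X V out r) (Xplus-outside X V out t)

    frob²-U-· : ∀ {k} (Y : Mat 2 k) → frob² (U B · Y) ≡ frob² Y
    frob²-U-· {k} Y = trans (sumF-image rowNorm² rowNorm²-outside) (sumF-cong 2 rowNorm²-image)
      where
      rowNorm² : Fin n → ℝ
      rowNorm² l = sumF k (λ j → (U B · Y) l j * (U B · Y) l j)
      rowNorm²-outside : ∀ l → OutsideImage B l → rowNorm² l ≡ 0r
      rowNorm²-outside l outside =
        sumF-zero k (λ j → trans (cong (_* (U B · Y) l j) (U-·-outside B Y outside j)) (zeroˡ _))
      rowNorm²-image : ∀ a → rowNorm² (B a) ≡ sumF k (λ j → Y a j * Y a j)
      rowNorm²-image a = sumF-cong k (λ j → cong₂ _*_ (U-·-image Y a j) (U-·-image Y a j))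

    frob²-Uᵀ-·-≤ : ∀ {k} (M : Mat n k) → frob² (U B ᵀ · M) ≤ frob² M
    frob²-Uᵀ-·-≤ {k} M = subst (_≤ frob² M) (sumF-cong 2 rowNorm²-image)
      (sumF-image-≤ rowNorm² (λ l → sumF-nonneg k (λ j → square-nonneg (M l j))))
      where
      rowNorm² : Fin n → ℝ
      rowNorm² l = sumF k (λ j → M l j * M l j)
      rowNorm²-image : ∀ a →
        rowNorm² (B a) ≡ sumF k (λ j → (U B ᵀ · M) a j * (U B ᵀ · M) a j)
      rowNorm²-image a = sumF-cong k (λ j → sym (cong₂ _*_ (Uᵀ-· B M a j) (Uᵀ-· B M a j)))

    Xplus-frob²-≤ : ∀ X V → frob² (Xplus B X V ⊖ X) ≤ frob² X * frob² (V ⊖ I 2)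
    Xplus-frob²-≤ X V = begin
      frob² (Xplus B X V ⊖ X)  ≡⟨ frob²-cong (Xplus-⊖ B X V) ⟩
      frob² ((U B · A) · Z)     ≡⟨ frob²-cong (·-assoc (U B) A Z) ⟩
      frob² (U B · (A · Z))     ≡⟨ frob²-U-· (A · Z) ⟩
      frob² (A · Z)             ≤⟨ frob²-·-≤ A Z ⟩
      frob² A * frob² Z         ≤⟨ *-monoˡ-≤ (frob²-nonneg A) (frob²-Uᵀ-·-≤ X) ⟩
      frob² A * frob² X         ≡⟨ *-comm (frob² A) (frob² X) ⟩
      frob² X * frob² A         ∎
      where
      open ≤-Reasoning
      A = V ⊖ I 2
      Z = U B ᵀ · X

lemma1 : (R : Reals) → let open RealMatrices R in
    (n p : ℕ) → 2 ℕ.≤ n → p ℕ.≤ n →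
    (B : Fin 2 → Fin n) → B zero ≢ B (suc zero) →
    (X : Mat n n) (V : Mat 2 2) (H : Mat (n ℕ.* n) (n ℕ.* n)) →
    Symmetric H → PSD H →
    ((IsJOrth (sub (Jmat n p) B) V → IsJOrth (Jmat n p) X →
        IsJOrth (Jmat n p) (Xplus B X V))
     × (frob² (Xplus B X V ⊖ X) ≤ frob² X * frob² (V ⊖ I 2))
     × ((Q : Mat (2 ℕ.* 2) (2 ℕ.* 2)) → Symmetric Q →
        Q ≽ (((((U B ᵀ) · X) ᵀ) ⊗ U B) ᵀ · (H · ((((U B ᵀ) · X) ᵀ) ⊗ U B))) →
        norm² (Xplus B X V ⊖ X) H ≤ norm² (V ⊖ I 2) Q))
lemma1 R n p _ _ B B₀≢B₁ X V H _ _ =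
    Xplus-IsJOrth B B₀≢B₁ (Jmat-diagonal n p) X V
  , Xplus-frob²-≤ B B₀≢B₁ X V
  , λ Q _ → Xplus-norm²-≤ B X V H Q
  where open RealMatrixAlgebra R
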